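{- Let $k>0$, let $\alpha=(\alpha_1,\dots,\alpha_r)\in[k]^r$ with $\alpha_1+\cdots+\alpha_r=n$, and fix $k$ distinct rational numbers $\eta_1,\dots,\eta_k$. Let $Z_{\alpha,k}\subseteq\mathbb{Q}^n$ be the set of points $(z_1,\dots,z_n)$ such that $\{z_1,\dots,z_n\}=\{\eta_1,\dots,\eta_k\}$ and, for each $1\le i\le r$, the coordinates $z_{\alpha_1+\cdots+\alpha_{i-1}+1},\dots,z_{\alpha_1+\cdots+\alpha_{i-1}+\alpha_i}$ are pairwise distinct. Then $J_{\alpha,k}\subseteq\mathbf{T}(Z_{\alpha,k})$.
   Context: $J_{\alpha,k}\subseteq\mathbb{Q}[x_1,\dots,x_n]$ is the ideal generated by $e_n(\mathbf{x}_n),e_{n-1}(\mathbf{x}_n),\dots,e_{n-k+1}(\mathbf{x}_n)$ (elementary symmetric polynomials in all variables) and by $h_{k-\alpha_i+1}(\mathbf{x}^{(i)}_n),\dots,h_k(\mathbf{x}^{(i)}_n)$ for $1\le i\le r$ (complete homogeneous symmetric polynomials), where $\mathbf{x}^{(i)}_n=(x_{\alpha_1+\cdots+\alpha_{i-1}+1},\dots,x_{\alpha_1+\cdots+\alpha_i})$. For a finite set $Z\subseteq\mathbb{Q}^n$, $\mathbf{I}(Z)$ is the ideal of polynomials vanishing on $Z$, and $\mathbf{T}(Z)$ is the ideal generated by the top-degree homogeneous components $\tau(f)$ of all nonzero $f\in\mathbf{I}(Z)$. -}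

module Defs where

open import Data.Nat as ℕ using (ℕ; zero; suc; _≤_; _<_; _⊔_)
import Data.Nat.Properties as ℕP
open import Data.Fin as Fin using (Fin; toℕ)
open import Data.Fin.Properties as FinP using ()
open import Data.Vec as Vec using (Vec; tabulate)
import Data.Vec.Properties as VecP
open import Data.List as List using (List; []; _∷_; _++_; allFin; filter; foldr)
open import Data.List.Relation.Unary.All using (All)
import Data.Nat.ListAction as ListAction
open import Data.Rational as ℚ using (ℚ; 0ℚ; 1ℚ)
import Data.Rational.Properties as ℚP
open import Data.Product using (Σ; ∃; ∃-syntax; _×_; _,_; proj₁; proj₂)
open import Data.Sum using (_⊎_)
open import Data.Bool using (if_then_else_)
open import Relation.Nullary using (¬_; does)
open import Relation.Nullary.Decidable using (_×-dec_)
open import Relation.Binary.PropositionalEquality using (_≡_)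
open import Function using (Injective)

-- Polynomials in n variables x_0,…,x_{n-1} over ℚ, represented as formal
-- (non-normalised) sums of terms  q · x^m  with exponent vector m.

Mono : ℕ → Set
Mono n = Vec ℕ n

Poly : ℕ → Set
Poly n = List (ℚ × Mono n)

module _ {n : ℕ} where

  coeff : Poly n → Mono n → ℚ
  coeff [] m = 0ℚ
  coeff ((q , m') ∷ f) m =
    if does (VecP.≡-dec ℕP._≟_ m' m) then q ℚ.+ coeff f m else coeff f m

  _≈_ : Poly n → Poly n → Set
  f ≈ g = ∀ m → coeff f m ≡ coeff g m

  NonZero : Poly n → Set
  NonZero f = ∃[ m ] ¬ (coeff f m ≡ 0ℚ)

  0P : Poly n
  0P = []

  1P : Poly n
  1P = (1ℚ , Vec.replicate n 0) ∷ []

  var : Fin n → Poly n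
  var j = (1ℚ , tabulate (λ l → if does (l Fin.≟ j) then 1 else 0)) ∷ []

  _+P_ : Poly n → Poly n → Poly n
  f +P g = f ++ g

  _*P_ : Poly n → Poly n → Poly n
  f *P g = List.concatMap
    (λ t → List.map (λ s → (proj₁ t ℚ.* proj₁ s , Vec.zipWith ℕ._+_ (proj₂ t) (proj₂ s))) g) f

  sumP : List (Poly n) → Poly n
  sumP = foldr _+P_ 0P

  mdeg : Mono n → ℕ
  mdeg m = Vec.sum m

  -- degree of f: the largest total degree of a monomial with nonzero coefficient
  -- (0 for the zero polynomial)
  deg : Poly n → ℕ
  deg f = foldr (λ t acc → if does (coeff f (proj₂ t) ℚP.≟ 0ℚ) then acc else mdeg (proj₂ t) ⊔ acc) 0 f

  τ : Poly n → Poly n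
  τ f = filter (λ t → mdeg (proj₂ t) ℕP.≟ deg f) f

  powQ : ℚ → ℕ → ℚ
  powQ q zero = 1ℚ
  powQ q (suc e) = q ℚ.* powQ q e

  eval : Poly n → (Fin n → ℚ) → ℚ
  eval f z = foldr (λ t acc → (proj₁ t ℚ.* monoEval (proj₂ t)) ℚ.+ acc) 0ℚ f
    where
    monoEval : Mono n → ℚ
    monoEval m = foldr ℚ._*_ 1ℚ (List.map (λ i → powQ (z i) (Vec.lookup m i)) (allFin n))

  _∈⟨_⟩ : Poly n → (Poly n → Set) → Set
  p ∈⟨ S ⟩ = ∃[ cs ] (All (λ cg → S (proj₂ cg)) cs ×
                     (p ≈ sumP (List.map (λ cg → proj₁ cg *P proj₂ cg) cs)))

  𝐈 : ((Fin n → ℚ) → Set) → Poly n → Set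
  𝐈 Z f = ∀ z → Z z → eval f z ≡ 0ℚ

  TGen : ((Fin n → ℚ) → Set) → Poly n → Set
  TGen Z g = ∃[ f ] (𝐈 Z f × NonZero f × g ≡ τ f)

  𝐓 : ((Fin n → ℚ) → Set) → Poly n → Set
  𝐓 Z p = p ∈⟨ TGen Z ⟩

  e : ℕ → List (Fin n) → Poly n
  e zero vs = 1P
  e (suc d) [] = 0P
  e (suc d) (v ∷ vs) = (var v *P e d vs) +P e (suc d) vs

  h : ℕ → List (Fin n) → Poly n
  h zero vs = 1P
  h (suc d) [] = 0P
  h (suc d) (v ∷ vs) = (var v *P h d (v ∷ vs)) +P h (suc d) vs

-- Blocks of a composition α = (α_1,…,α_r) (0-indexed: α : Fin r → ℕ)

module _ {r : ℕ} (α : Fin r → ℕ) where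

  -- α_1 + ⋯ + α_{i-1}  (for 0-indexed i: sum of α l over l < i)
  offset : Fin r → ℕ
  offset i = ListAction.sum (List.map α (filter (λ l → toℕ l ℕP.<? toℕ i) (allFin r)))

  InBlock : {n : ℕ} → Fin r → Fin n → Set
  InBlock i j = offset i ≤ toℕ j × toℕ j < offset i ℕ.+ α i

  block : (n : ℕ) → Fin r → List (Fin n)
  block n i = filter (λ j → (offset i ℕP.≤? toℕ j) ×-dec (toℕ j ℕP.<? offset i ℕ.+ α i)) (allFin n)

  -- generating set of J_{α,k}:  e_d(x) for n-k+1 ≤ d ≤ n, and
  -- h_d(x^{(i)}) for k-α_i+1 ≤ d ≤ k
  JGen : (n k : ℕ) → Poly n → Set
  JGen n k g =
      (∃[ d ] (n < d ℕ.+ k × d ≤ n × g ≡ e d (allFin n)))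
    ⊎ (∃[ i ] ∃[ d ] (k < d ℕ.+ α i × d ≤ k × g ≡ h d (block n i)))

  𝐉 : (n k : ℕ) → Poly n → Set
  𝐉 n k p = p ∈⟨ JGen n k ⟩

  Zαk : (n k : ℕ) → (Fin k → ℚ) → (Fin n → ℚ) → Set
  Zαk n k η z =
      (∀ j → ∃[ l ] z j ≡ η l)
    × (∀ l → ∃[ j ] z j ≡ η l)
    × (∀ i j j' → InBlock i j → InBlock i j' → z j ≡ z j' → j ≡ j')

module Submission where

open import Defs
open import Data.Nat using (ℕ; _≤_; _<_)
open import Data.Fin using (Fin)
open import Data.List using (allFin; map)
open import Data.Nat.ListAction using (sum)
open import Data.Rational using (ℚ)
open import Relation.Binary.PropositionalEquality using (_≡_)
open import Function using (Injective)

-- It suffices to show that every generator g of J_{α,k} is τ(f) for some nonzero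
-- f vanishing on Z = Z_{α,k}.  Write S = (η_1, …, η_k) and use generating series
-- in an auxiliary variable t:  E(X,t) = ∏_{x∈X} (1 + x t),  H(X,t) = ∏_{x∈X} (1 - x t)⁻¹.
--  * g = e_d(x), n - k < d ≤ n:  take f = [tᵈ] E(x,t) / ∏_l (1 + η_l t).  At z ∈ Z the
--    values z_1, …, z_n contain every η_l, so E(z,t) = E(S,t) E(C,t) with |C| = n - k,
--    and f(z) = e_d(C) = 0 because d > |C|.
--  * g = h_d(x^{(i)}), k - α_i < d ≤ k:  take f = [tᵈ] H(x^{(i)},t) · ∏_l (1 - η_l t).
--    At z ∈ Z the block values are distinct elements of S, so S = z^{(i)} ⊎ C with
--    |C| = k - α_i, and f(z) = [tᵈ] ∏_{c∈C} (1 - c t) = 0.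
-- In both cases f = g + (terms of lower degree), and g is a nonempty sum of monomials
-- with coefficient 1, so f ≠ 0 and τ(f) = g.

module PowerSeries where

  open import Data.Nat as ℕ using (ℕ; zero; suc; _<_; s≤s)
  import Data.Nat.Properties as ℕP
  open import Data.List as List using (List; []; _∷_; _++_; length; foldr)
  import Data.List.Properties as LP
  open import Data.List.Relation.Binary.Permutation.Propositional using (_↭_; prep; swap) renaming (refl to ↭-refl; trans to ↭-trans)
  import Data.List.Relation.Binary.Permutation.Propositional.Properties as PermP
  open import Data.Rational as ℚ using (ℚ; 0ℚ; 1ℚ; _+_; _*_; -_)
  open import Data.Rational.Solver
  open +-*-Solver using (solve; _:+_; _:*_; :-_; _:=_; con)
  open import Relation.Binary.PropositionalEquality

  -- A sequence a : ℕ → ℚ stands for the formal power series Σ_d a d · tᵈ.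
  Seq : Set
  Seq = ℕ → ℚ

  one : Seq
  one zero = 1ℚ
  one (suc d) = 0ℚ

  -- Multiplication by the linear factor (1 + c t).
  mulBy : ℚ → Seq → Seq
  mulBy c a zero = a zero
  mulBy c a (suc d) = c * a d + a (suc d)

  -- Division by the linear factor (1 - c t), i.e. multiplication by Σ_j cʲ tʲ.
  divBy : ℚ → Seq → Seq
  divBy c a zero = a zero
  divBy c a (suc d) = c * divBy c a d + a (suc d)

  mulBy-cong : ∀ c {a b : Seq} → a ≗ b → mulBy c a ≗ mulBy c b
  mulBy-cong c a≗b zero = a≗b zero
  mulBy-cong c a≗b (suc d) = cong₂ (λ u v → c * u + v) (a≗b d) (a≗b (suc d))

  divBy-cong : ∀ c {a b : Seq} → a ≗ b → divBy c a ≗ divBy c b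
  divBy-cong c a≗b zero = a≗b zero
  divBy-cong c a≗b (suc d) = cong₂ (λ u v → c * u + v) (divBy-cong c a≗b d) (a≗b (suc d))

  mulBy-comm : ∀ c c' (a : Seq) → mulBy c (mulBy c' a) ≗ mulBy c' (mulBy c a)
  mulBy-comm c c' a zero = refl
  mulBy-comm c c' a (suc zero) =
    solve 4 (λ c c' x y → c :* x :+ (c' :* x :+ y) := c' :* x :+ (c :* x :+ y)) refl c c' (a 0) (a 1)
  mulBy-comm c c' a (suc (suc d)) =
    solve 5 (λ c c' x y w → c :* (c' :* x :+ y) :+ (c' :* y :+ w) := c' :* (c :* x :+ y) :+ (c :* y :+ w)) refl
      c c' (a d) (a (suc d)) (a (suc (suc d)))

  divBy-mulBy-comm : ∀ c c' (a : Seq) → divBy c (mulBy c' a) ≗ mulBy c' (divBy c a)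
  divBy-mulBy-comm c c' a zero = refl
  divBy-mulBy-comm c c' a (suc zero) =
    solve 4 (λ c c' x y → c :* x :+ (c' :* x :+ y) := c' :* x :+ (c :* x :+ y)) refl c c' (a 0) (a 1)
  divBy-mulBy-comm c c' a (suc (suc d)) =
    trans (cong (λ u → c * u + (c' * a (suc d) + a (suc (suc d)))) (divBy-mulBy-comm c c' a (suc d)))
      (solve 5 (λ c c' x y w → c :* (c' :* x :+ (c :* x :+ y)) :+ (c' :* y :+ w)
                            := c' :* (c :* x :+ y) :+ (c :* (c :* x :+ y) :+ w)) refl
        c c' (divBy c a d) (a (suc d)) (a (suc (suc d))))

  divBy-cancel : ∀ c (a : Seq) → divBy (- c) (mulBy c a) ≗ a
  divBy-cancel c a zero = refl
  divBy-cancel c a (suc d) =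
    trans (cong (λ u → (- c) * u + (c * a d + a (suc d))) (divBy-cancel c a d))
      (solve 3 (λ c x y → (:- c) :* x :+ (c :* x :+ y) := y) refl c (a d) (a (suc d)))

  mulBy-cancel : ∀ c (a : Seq) → mulBy (- c) (divBy c a) ≗ a
  mulBy-cancel c a zero = refl
  mulBy-cancel c a (suc d) =
    solve 3 (λ c x y → (:- c) :* x :+ (c :* x :+ y) := y) refl c (divBy c a d) (a (suc d))

  mulAll : List ℚ → Seq → Seq
  mulAll S a = foldr mulBy a S

  divAll : List ℚ → Seq → Seq
  divAll S a = foldr divBy a S

  mulAll-at-0 : ∀ S (a : Seq) → mulAll S a 0 ≡ a 0
  mulAll-at-0 [] a = refl
  mulAll-at-0 (s ∷ S) a = mulAll-at-0 S a

  divAll-at-0 : ∀ S (a : Seq) → divAll S a 0 ≡ a 0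
  divAll-at-0 [] a = refl
  divAll-at-0 (s ∷ S) a = divAll-at-0 S a

  mulAll-cong : ∀ S {a b : Seq} → a ≗ b → mulAll S a ≗ mulAll S b
  mulAll-cong [] a≗b = a≗b
  mulAll-cong (s ∷ S) a≗b = mulBy-cong s (mulAll-cong S a≗b)

  divAll-cong : ∀ S {a b : Seq} → a ≗ b → divAll S a ≗ divAll S b
  divAll-cong [] a≗b = a≗b
  divAll-cong (s ∷ S) a≗b = divBy-cong s (divAll-cong S a≗b)

  mulAll-↭ : ∀ {S S'} → S ↭ S' → (a : Seq) → mulAll S a ≗ mulAll S' a
  mulAll-↭ ↭-refl a = λ _ → refl
  mulAll-↭ (prep s p) a = mulBy-cong s (mulAll-↭ p a)
  mulAll-↭ {x ∷ y ∷ S} (swap x y p) a d =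
    trans (mulBy-comm x y (mulAll S a) d) (mulBy-cong y (mulBy-cong x (mulAll-↭ p a)) d)
  mulAll-↭ (↭-trans p q) a d = trans (mulAll-↭ p a d) (mulAll-↭ q a d)

  divAll-mulBy-comm : ∀ S c (a : Seq) → divAll S (mulBy c a) ≗ mulBy c (divAll S a)
  divAll-mulBy-comm [] c a = λ _ → refl
  divAll-mulBy-comm (s ∷ S) c a d =
    trans (divBy-cong s (divAll-mulBy-comm S c a) d) (divBy-mulBy-comm s c (divAll S a) d)

  mulAll-divBy-comm : ∀ S c (a : Seq) → mulAll S (divBy c a) ≗ divBy c (mulAll S a)
  mulAll-divBy-comm [] c a = λ _ → refl
  mulAll-divBy-comm (s ∷ S) c a d =
    trans (mulBy-cong s (mulAll-divBy-comm S c a) d) (sym (divBy-mulBy-comm c s (mulAll S a) d))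

  divAll-cancel : ∀ S (a : Seq) → divAll (List.map -_ S) (mulAll S a) ≗ a
  divAll-cancel [] a = λ _ → refl
  divAll-cancel (s ∷ S) a d =
    trans (divBy-cong (- s) (divAll-mulBy-comm (List.map -_ S) s (mulAll S a)) d)
      (trans (divBy-cancel s (divAll (List.map -_ S) (mulAll S a)) d) (divAll-cancel S a d))

  mulAll-cancel : ∀ S (a : Seq) → mulAll (List.map -_ S) (divAll S a) ≗ a
  mulAll-cancel [] a = λ _ → refl
  mulAll-cancel (s ∷ S) a d =
    trans (mulBy-cong (- s) (mulAll-divBy-comm (List.map -_ S) s (divAll S a)) d)
      (trans (mulBy-cancel s (mulAll (List.map -_ S) (divAll S a)) d) (mulAll-cancel S a d))

  esym : List ℚ → Seq
  esym X = mulAll X one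

  hsym : List ℚ → Seq
  hsym X = divAll X one

  esym-vanishes : ∀ C d → length C < d → esym C d ≡ 0ℚ
  esym-vanishes [] (suc d) _ = refl
  esym-vanishes (c ∷ C) (suc d) (s≤s |C|<d) =
    trans (cong₂ (λ u v → c * u + v) (esym-vanishes C d |C|<d) (esym-vanishes C (suc d) (ℕP.m<n⇒m<1+n |C|<d)))
      (solve 1 (λ c → c :* con 0ℚ :+ con 0ℚ := con 0ℚ) refl c)

  mulAll-++ : ∀ S T (a : Seq) → mulAll (S ++ T) a ≡ mulAll S (mulAll T a)
  mulAll-++ S T a = LP.foldr-++ mulBy a S T

  -- If the multiset X contains the list S, with complement C, then
  -- E(X)/∏_{s∈S}(1 + s t) = E(C) has no terms of degree above |C|.
  esym-quotient-vanishes : ∀ {X} S C → X ↭ S ++ C → ∀ d → length C < d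
                         → divAll (List.map -_ S) (esym X) d ≡ 0ℚ
  esym-quotient-vanishes {X} S C X↭S++C d |C|<d = begin
    divAll -S (esym X) d               ≡⟨ divAll-cong -S (mulAll-↭ X↭S++C one) d ⟩
    divAll -S (esym (S ++ C)) d        ≡⟨ cong (λ a → divAll -S a d) (mulAll-++ S C one) ⟩
    divAll -S (mulAll S (esym C)) d    ≡⟨ divAll-cancel S (esym C) d ⟩
    esym C d                           ≡⟨ esym-vanishes C d |C|<d ⟩
    0ℚ                                 ∎
    where
    open ≡-Reasoning
    -S = List.map -_ S

  -- If the multiset S contains the list A, with complement C, then
  -- H(A)·∏_{s∈S}(1 - s t) = ∏_{c∈C}(1 - c t) has no terms of degree above |C|.
  hsym-product-vanishes : ∀ {S} A C → S ↭ A ++ C → ∀ d → length C < d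
                        → mulAll (List.map -_ S) (hsym A) d ≡ 0ℚ
  hsym-product-vanishes {S} A C S↭A++C d |C|<d = begin
    mulAll (List.map -_ S) (hsym A) d      ≡⟨ mulAll-↭ -S↭-C++-A (hsym A) d ⟩
    mulAll (-C ++ -A) (hsym A) d           ≡⟨ cong (λ a → a d) (mulAll-++ -C -A (hsym A)) ⟩
    mulAll -C (mulAll -A (hsym A)) d       ≡⟨ mulAll-cong -C (mulAll-cancel A one) d ⟩
    esym -C d                              ≡⟨ esym-vanishes -C d (subst (_< d) (sym (LP.length-map -_ C)) |C|<d) ⟩
    0ℚ                                     ∎
    where
    open ≡-Reasoning
    -A = List.map -_ A
    -C = List.map -_ C
    -S↭-C++-A : List.map -_ S ↭ -C ++ -A
    -S↭-C++-A = ↭-trans (PermP.map⁺ -_ S↭A++C)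
                  (subst (_↭ -C ++ -A) (sym (LP.map-++ -_ A C)) (PermP.++-comm -A -C))


module Evaluation where

  open PowerSeries
  open import Data.Nat as ℕ using (ℕ; zero; suc)
  open import Data.Fin as Fin using (Fin)
  import Data.Vec as Vec
  import Data.Vec.Properties as VecP
  open import Data.List as List using ([]; _∷_; _++_; allFin; foldr)
  import Data.List.Properties as LP
  open import Data.Rational as ℚ using (ℚ; 0ℚ; 1ℚ; _+_; _*_)
  import Data.Rational.Properties as ℚP
  open import Data.Rational.Solver
  open +-*-Solver using (solve; _:+_; _:*_; _:=_; con)
  open import Data.Product using (_×_; _,_; proj₁; proj₂)
  open import Data.Bool using (if_then_else_)
  open import Relation.Nullary using (does)
  open import Function using (_∘_)
  open import Relation.Binary.PropositionalEquality

  unitMono : ∀ {m} → Fin m → Fin m → ℕ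
  unitMono v i = if does (i Fin.≟ v) then 1 else 0

  module _ {n : ℕ} where

    -- Powers as used by `eval` (the argument n of `powQ` is immaterial).
    pow : ℚ → ℕ → ℚ
    pow = powQ {n}

    prod : ∀ {m} → (Fin m → ℚ) → ℚ
    prod f = foldr _*_ 1ℚ (List.tabulate f)

    prod-raise : ∀ {m} (w : Fin m → ℚ) (b : Fin m → ℕ) v →
                 prod (λ i → pow (w i) (unitMono v i ℕ.+ b i)) ≡ w v * prod (λ i → pow (w i) (b i))
    prod-raise w b Fin.zero = ℚP.*-assoc (w Fin.zero) (pow (w Fin.zero) (b Fin.zero)) _
    prod-raise w b (Fin.suc v) =
      trans (cong (pow (w Fin.zero) (b Fin.zero) *_) (prod-raise (w ∘ Fin.suc) (b ∘ Fin.suc) v))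
        (solve 3 (λ p x q → p :* (x :* q) := x :* (p :* q)) refl
          (pow (w Fin.zero) (b Fin.zero)) (w (Fin.suc v)) (prod (λ i → pow (w (Fin.suc i)) (b (Fin.suc i)))))

    prod-zero-exponents : ∀ {m} (w : Fin m → ℚ) → prod (λ i → pow (w i) (Vec.lookup (Vec.replicate m 0) i)) ≡ 1ℚ
    prod-zero-exponents {zero} w = refl
    prod-zero-exponents {suc m} w = trans (cong (1ℚ *_) (prod-zero-exponents (w ∘ Fin.suc))) (ℚP.*-identityˡ 1ℚ)

    -- The value of the monomial x^m at z, exactly as computed inside `eval`.
    monoEval : (Fin n → ℚ) → Mono n → ℚ
    monoEval z m = foldr _*_ 1ℚ (List.map (λ i → pow (z i) (Vec.lookup m i)) (allFin n))

    monoEval-prod : ∀ z m → monoEval z m ≡ prod (λ i → pow (z i) (Vec.lookup m i))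
    monoEval-prod z m = cong (foldr _*_ 1ℚ) (LP.map-tabulate (λ i → i) (λ i → pow (z i) (Vec.lookup m i)))

    monoEval-raise : ∀ z v (m : Mono n) →
                     monoEval z (Vec.zipWith ℕ._+_ (Vec.tabulate (unitMono v)) m) ≡ z v * monoEval z m
    monoEval-raise z v m = begin
      monoEval z (Vec.zipWith ℕ._+_ δ m)                  ≡⟨ monoEval-prod z (Vec.zipWith ℕ._+_ δ m) ⟩
      prod (λ i → pow (z i) (Vec.lookup (Vec.zipWith ℕ._+_ δ m) i))
                                                          ≡⟨ cong (foldr _*_ 1ℚ) (LP.tabulate-cong exponent) ⟩
      prod (λ i → pow (z i) (unitMono v i ℕ.+ Vec.lookup m i))
                                                          ≡⟨ prod-raise z (Vec.lookup m) v ⟩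
      z v * prod (λ i → pow (z i) (Vec.lookup m i))       ≡⟨ cong (z v *_) (monoEval-prod z m) ⟨
      z v * monoEval z m                                  ∎
      where
      open ≡-Reasoning
      δ = Vec.tabulate (unitMono v)
      exponent : ∀ i → pow (z i) (Vec.lookup (Vec.zipWith ℕ._+_ δ m) i) ≡ pow (z i) (unitMono v i ℕ.+ Vec.lookup m i)
      exponent i = cong (pow (z i)) (trans (VecP.lookup-zipWith ℕ._+_ i δ m)
                                           (cong (ℕ._+ Vec.lookup m i) (VecP.lookup∘tabulate (unitMono v) i)))

    eval-++ : ∀ (f g : Poly n) z → eval (f ++ g) z ≡ eval f z + eval g z
    eval-++ [] g z = sym (ℚP.+-identityˡ _)
    eval-++ ((q , m) ∷ f) g z =
      trans (cong (q * monoEval z m +_) (eval-++ f g z)) (sym (ℚP.+-assoc (q * monoEval z m) (eval f z) (eval g z)))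

    scale : ℚ → Poly n → Poly n
    scale c = List.map (λ t → (c * proj₁ t , proj₂ t))

    eval-scale : ∀ c (f : Poly n) z → eval (scale c f) z ≡ c * eval f z
    eval-scale c [] z = sym (ℚP.*-zeroʳ c)
    eval-scale c ((q , m) ∷ f) z =
      trans (cong (c * q * monoEval z m +_) (eval-scale c f z))
        (solve 4 (λ c q x y → c :* q :* x :+ c :* y := c :* (q :* x :+ y)) refl c q (monoEval z m) (eval f z))

    eval-1P : ∀ z → eval (1P {n}) z ≡ 1ℚ
    eval-1P z = cong (λ u → 1ℚ * u + 0ℚ) (trans (monoEval-prod z (Vec.replicate n 0)) (prod-zero-exponents z))

    -- A term multiplied by x_v; by definition  var v *P g = map (raiseTerm v) g ++ [].
    raiseTerm : Fin n → ℚ × Mono n → ℚ × Mono n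
    raiseTerm v s = (1ℚ * proj₁ s , Vec.zipWith ℕ._+_ (Vec.tabulate (unitMono v)) (proj₂ s))

    eval-var* : ∀ v (g : Poly n) z → eval (var v *P g) z ≡ z v * eval g z
    eval-var* v g z = trans (eval-++ (List.map (raiseTerm v) g) [] z) (trans (ℚP.+-identityʳ _) (eval-raise g))
      where
      eval-raise : ∀ g → eval (List.map (raiseTerm v) g) z ≡ z v * eval g z
      eval-raise [] = sym (ℚP.*-zeroʳ (z v))
      eval-raise ((q , m) ∷ g) =
        trans (cong₂ (λ a b → 1ℚ * q * a + b) (monoEval-raise z v m) (eval-raise g))
          (solve 4 (λ q x a b → con 1ℚ :* q :* (x :* a) :+ x :* b := x :* (q :* a :+ b)) refl
            q (z v) (monoEval z m) (eval g z))


module TopDegree where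

  open import Data.Nat as ℕ using (ℕ; _≤_; _⊔_; z≤n)
  import Data.Nat.Properties as ℕP
  import Data.Vec.Properties as VecP
  open import Data.List as List using ([]; _∷_; foldr; filter)
  import Data.List.Properties as LP
  open import Data.List.Relation.Unary.All as All using (All; []; _∷_)
  open import Data.List.Relation.Unary.Any using (here; there)
  open import Data.List.Membership.Propositional using (_∈_)
  open import Data.List.Membership.Propositional.Properties using (∈-filter⁻)
  open import Data.Rational as ℚ using (ℚ; 0ℚ; 1ℚ; _+_)
  import Data.Rational.Properties as ℚP
  open import Data.Product using (_×_; _,_; proj₁; proj₂; ∃-syntax)
  open import Data.Bool using (if_then_else_)
  open import Data.Unit using (tt)
  open import Data.Empty using (⊥-elim)
  open import Relation.Nullary using (does; yes; no; Dec)
  open import Relation.Nullary.Decidable using (toWitness)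
  open import Relation.Unary using (Decidable)
  open import Relation.Binary.PropositionalEquality

  0<1 : 0ℚ ℚ.< 1ℚ
  0<1 = toWitness {a? = 0ℚ ℚP.<? 1ℚ} tt

  module _ {n : ℕ} where

    ofDegree? : (d : ℕ) → Decidable (λ (t : ℚ × Mono n) → mdeg (proj₂ t) ≡ d)
    ofDegree? d t = mdeg (proj₂ t) ℕP.≟ d

    DegreeAtMost : ℕ → Poly n → Set
    DegreeAtMost d = All (λ t → mdeg (proj₂ t) ≤ d)

    TopPart : ℕ → Poly n → Poly n → Set
    TopPart d f g = DegreeAtMost d f × filter (ofDegree? d) f ≡ g

    MonicOfDegree : ℕ → Poly n → Set
    MonicOfDegree d = All (λ t → proj₁ t ≡ 1ℚ × mdeg (proj₂ t) ≡ d)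

    coeff-here : ∀ q {m' m : Mono n} f → m' ≡ m → coeff ((q , m') ∷ f) m ≡ q + coeff f m
    coeff-here q {m'} {m} f m'≡m with VecP.≡-dec ℕP._≟_ m' m
    ... | yes _ = refl
    ... | no m'≢m = ⊥-elim (m'≢m m'≡m)

    coeff-there : ∀ q {m' m : Mono n} f → m' ≢ m → coeff ((q , m') ∷ f) m ≡ coeff f m
    coeff-there q {m'} {m} f m'≢m with VecP.≡-dec ℕP._≟_ m' m
    ... | yes m'≡m = ⊥-elim (m'≢m m'≡m)
    ... | no _ = refl

    coeff-filter : ∀ (f : Poly n) m → coeff f m ≡ coeff (filter (ofDegree? (mdeg m)) f) m
    coeff-filter [] m = refl
    coeff-filter ((q , m') ∷ f) m = by-cases (VecP.≡-dec ℕP._≟_ m' m) (mdeg m' ℕP.≟ mdeg m)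
      where
      open ≡-Reasoning
      P? = ofDegree? (mdeg m)
      by-cases : Dec (m' ≡ m) → Dec (mdeg m' ≡ mdeg m)
               → coeff ((q , m') ∷ f) m ≡ coeff (filter P? ((q , m') ∷ f)) m
      by-cases (yes m'≡m) _ = begin
        coeff ((q , m') ∷ f) m                   ≡⟨ coeff-here q f m'≡m ⟩
        q + coeff f m                            ≡⟨ cong (q +_) (coeff-filter f m) ⟩
        q + coeff (filter P? f) m                ≡⟨ coeff-here q (filter P? f) m'≡m ⟨
        coeff ((q , m') ∷ filter P? f) m         ≡⟨ cong (λ L → coeff L m) (LP.filter-accept P? {q , m'} {f} (cong mdeg m'≡m)) ⟨
        coeff (filter P? ((q , m') ∷ f)) m       ∎
      by-cases (no m'≢m) (yes same) = begin
        coeff ((q , m') ∷ f) m                   ≡⟨ coeff-there q f m'≢m ⟩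
        coeff f m                                ≡⟨ coeff-filter f m ⟩
        coeff (filter P? f) m                    ≡⟨ coeff-there q (filter P? f) m'≢m ⟨
        coeff ((q , m') ∷ filter P? f) m         ≡⟨ cong (λ L → coeff L m) (LP.filter-accept P? {q , m'} {f} same) ⟨
        coeff (filter P? ((q , m') ∷ f)) m       ∎
      by-cases (no m'≢m) (no differ) = begin
        coeff ((q , m') ∷ f) m                   ≡⟨ coeff-there q f m'≢m ⟩
        coeff f m                                ≡⟨ coeff-filter f m ⟩
        coeff (filter P? f) m                    ≡⟨ cong (λ L → coeff L m) (LP.filter-reject P? {q , m'} {f} differ) ⟨
        coeff (filter P? ((q , m') ∷ f)) m       ∎

    monic-coeff-nonneg : ∀ {d} (g : Poly n) → MonicOfDegree d g → ∀ m → 0ℚ ℚ.≤ coeff g m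
    monic-coeff-nonneg [] _ m = ℚP.≤-refl
    monic-coeff-nonneg ((q , m') ∷ g) ((q≡1 , _) ∷ monic) m with VecP.≡-dec ℕP._≟_ m' m
    ... | yes _ rewrite q≡1 = ℚP.+-mono-≤ (ℚP.<⇒≤ 0<1) (monic-coeff-nonneg g monic m)
    ... | no _ = monic-coeff-nonneg g monic m

    monic-coeff-pos : ∀ {d} (g : Poly n) → MonicOfDegree d g → ∀ {t} → t ∈ g → 0ℚ ℚ.< coeff g (proj₂ t)
    monic-coeff-pos ((q , m) ∷ g) ((q≡1 , _) ∷ monic) (here refl) rewrite coeff-here q g (refl {x = m}) | q≡1 =
      ℚP.+-mono-<-≤ 0<1 (monic-coeff-nonneg g monic m)
    monic-coeff-pos ((q , m') ∷ g) ((q≡1 , _) ∷ monic) {t} (there t∈g) with VecP.≡-dec ℕP._≟_ m' (proj₂ t)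
    ... | yes _ rewrite q≡1 = ℚP.+-mono-<-≤ 0<1 (monic-coeff-nonneg g monic (proj₂ t))
    ... | no _ = monic-coeff-pos g monic t∈g

    degreeOver : (Mono n → ℚ) → Poly n → ℕ
    degreeOver c L = foldr (λ t acc → if does (c (proj₂ t) ℚP.≟ 0ℚ) then acc else mdeg (proj₂ t) ⊔ acc) 0 L

    degreeOver-≤ : ∀ c (L : Poly n) {d} → DegreeAtMost d L → degreeOver c L ≤ d
    degreeOver-≤ c [] _ = z≤n
    degreeOver-≤ c (t ∷ L) (le ∷ les) with c (proj₂ t) ℚP.≟ 0ℚ
    ... | yes _ = degreeOver-≤ c L les
    ... | no _ = ℕP.⊔-lub le (degreeOver-≤ c L les)

    degreeOver-≥ : ∀ c (L : Poly n) {t} → t ∈ L → c (proj₂ t) ≢ 0ℚ → mdeg (proj₂ t) ≤ degreeOver c L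
    degreeOver-≥ c (t ∷ L) (here refl) c≢0 with c (proj₂ t) ℚP.≟ 0ℚ
    ... | yes c≡0 = ⊥-elim (c≢0 c≡0)
    ... | no _ = ℕP.m≤m⊔n _ _
    degreeOver-≥ c (t' ∷ L) (there t∈L) c≢0 with c (proj₂ t') ℚP.≟ 0ℚ
    ... | yes _ = degreeOver-≥ c L t∈L c≢0
    ... | no _ = ℕP.≤-trans (degreeOver-≥ c L t∈L c≢0) (ℕP.m≤n⊔m _ _)

    top-component : ∀ {f g : Poly n} {d} → TopPart d f g → MonicOfDegree d g → ∃[ t ] t ∈ g
                  → g ≡ τ f × NonZero f
    top-component {f} {g} {d} (f≤d , top≡g) monic (t , t∈g) = g≡τf , (proj₂ t , coeff≢0)
      where
      t∈top : t ∈ filter (ofDegree? d) f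
      t∈top = subst (t ∈_) (sym top≡g) t∈g
      t∈f : t ∈ f
      t∈f = proj₁ (∈-filter⁻ (ofDegree? d) {xs = f} t∈top)
      deg-t : mdeg (proj₂ t) ≡ d
      deg-t = proj₂ (∈-filter⁻ (ofDegree? d) {xs = f} t∈top)
      same-coeff : coeff f (proj₂ t) ≡ coeff g (proj₂ t)
      same-coeff = trans (coeff-filter f (proj₂ t))
                     (trans (cong (λ D → coeff (filter (ofDegree? D) f) (proj₂ t)) deg-t)
                            (cong (λ L → coeff L (proj₂ t)) top≡g))
      coeff≢0 : coeff f (proj₂ t) ≢ 0ℚ
      coeff≢0 c≡0 = ℚP.<⇒≢ (monic-coeff-pos g monic t∈g) (sym (trans (sym same-coeff) c≡0))
      deg≡d : deg f ≡ d
      deg≡d = ℕP.≤-antisym (degreeOver-≤ (coeff f) f f≤d) (subst (_≤ deg f) deg-t (degreeOver-≥ (coeff f) f t∈f coeff≢0))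
      g≡τf : g ≡ τ f
      g≡τf = sym (trans (cong (λ D → filter (ofDegree? D) f) deg≡d) top≡g)


module SymmetricPolynomials where

  open PowerSeries
  open Evaluation
  open TopDegree
  open import Data.Nat as ℕ using (ℕ; zero; suc; _≤_; _<_; z≤n; s≤s)
  import Data.Nat.Properties as ℕP
  open import Algebra.Properties.CommutativeSemigroup ℕP.+-commutativeSemigroup using () renaming (interchange to +-interchange)
  open import Data.Fin as Fin using (Fin)
  open import Data.Vec as Vec using (Vec)
  open import Data.List as List using (List; []; _∷_; length)
  open import Data.List.Relation.Unary.All as All using ([]; _∷_)
  import Data.List.Relation.Unary.All.Properties as AllP
  open import Data.List.Relation.Unary.Any using (here)
  open import Data.List.Membership.Propositional using (_∈_)
  open import Data.List.Membership.Propositional.Properties using (∈-map⁺; ∈-++⁺ˡ)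
  open import Data.Rational as ℚ using (1ℚ; _+_; _*_)
  import Data.Rational.Properties as ℚP
  open import Data.Product using (_×_; _,_; proj₁; proj₂; ∃-syntax)
  open import Relation.Binary.PropositionalEquality

  sum-zipWith-+ : ∀ {m} (a b : Vec ℕ m) → Vec.sum (Vec.zipWith ℕ._+_ a b) ≡ Vec.sum a ℕ.+ Vec.sum b
  sum-zipWith-+ Vec.[] Vec.[] = refl
  sum-zipWith-+ (x Vec.∷ a) (y Vec.∷ b) = trans (cong (x ℕ.+ y ℕ.+_) (sum-zipWith-+ a b)) (+-interchange x y _ _)

  sum-unitMono : ∀ {m} (v : Fin m) → Vec.sum (Vec.tabulate (unitMono v)) ≡ 1
  sum-unitMono {suc m} Fin.zero = cong suc (sum-zeros m)
    where
    sum-zeros : ∀ m → Vec.sum (Vec.tabulate {m} (λ _ → 0)) ≡ 0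
    sum-zeros zero = refl
    sum-zeros (suc m) = sum-zeros m
  sum-unitMono {suc m} (Fin.suc v) = sum-unitMono v

  module _ {n : ℕ} where

    eval-e : ∀ d (vs : List (Fin n)) z → eval (e d vs) z ≡ esym (List.map z vs) d
    eval-e zero vs z = trans (eval-1P z) (sym (mulAll-at-0 (List.map z vs) one))
    eval-e (suc d) [] z = refl
    eval-e (suc d) (v ∷ vs) z =
      trans (eval-++ (var v *P e d vs) (e (suc d) vs) z)
        (cong₂ _+_ (trans (eval-var* v (e d vs) z) (cong (z v *_) (eval-e d vs z))) (eval-e (suc d) vs z))

    eval-h : ∀ d (vs : List (Fin n)) z → eval (h d vs) z ≡ hsym (List.map z vs) d
    eval-h zero vs z = trans (eval-1P z) (sym (divAll-at-0 (List.map z vs) one))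
    eval-h (suc d) [] z = refl
    eval-h (suc d) (v ∷ vs) z =
      trans (eval-++ (var v *P h d (v ∷ vs)) (h (suc d) vs) z)
        (cong₂ _+_ (trans (eval-var* v (h d (v ∷ vs)) z) (cong (z v *_) (eval-h d (v ∷ vs) z))) (eval-h (suc d) vs z))

    mdeg-raise : ∀ v (m : Mono n) → mdeg (Vec.zipWith ℕ._+_ (Vec.tabulate (unitMono v)) m) ≡ suc (mdeg m)
    mdeg-raise v m = trans (sum-zipWith-+ (Vec.tabulate (unitMono v)) m) (cong (ℕ._+ mdeg m) (sum-unitMono v))

    monic-1P : MonicOfDegree 0 (1P {n})
    monic-1P = (refl , sum-zeros n) ∷ []
      where
      sum-zeros : ∀ m → Vec.sum (Vec.replicate m 0) ≡ 0
      sum-zeros zero = refl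
      sum-zeros (suc m) = sum-zeros m

    monic-var* : ∀ v {d} (g : Poly n) → MonicOfDegree d g → MonicOfDegree (suc d) (var v *P g)
    monic-var* v g monic = AllP.++⁺ (AllP.map⁺ (All.map raised monic)) []
      where
      raised : ∀ {d t} → proj₁ t ≡ 1ℚ × mdeg (proj₂ t) ≡ d
             → proj₁ (raiseTerm v t) ≡ 1ℚ × mdeg (proj₂ (raiseTerm v t)) ≡ suc d
      raised {t = t} (q≡1 , deg≡d) = trans (ℚP.*-identityˡ (proj₁ t)) q≡1 , trans (mdeg-raise v (proj₂ t)) (cong suc deg≡d)

    nonempty-var* : ∀ v (g : Poly n) → ∃[ t ] t ∈ g → ∃[ t ] t ∈ var v *P g
    nonempty-var* v g (t , t∈g) = raiseTerm v t , ∈-++⁺ˡ (∈-map⁺ (raiseTerm v) t∈g)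

    monic-e : ∀ d (vs : List (Fin n)) → MonicOfDegree d (e d vs)
    monic-e zero vs = monic-1P
    monic-e (suc d) [] = []
    monic-e (suc d) (v ∷ vs) = AllP.++⁺ (monic-var* v (e d vs) (monic-e d vs)) (monic-e (suc d) vs)

    monic-h : ∀ d (vs : List (Fin n)) → MonicOfDegree d (h d vs)
    monic-h zero vs = monic-1P
    monic-h (suc d) [] = []
    monic-h (suc d) (v ∷ vs) = AllP.++⁺ (monic-var* v (h d (v ∷ vs)) (monic-h d (v ∷ vs))) (monic-h (suc d) vs)

    nonempty-e : ∀ d (vs : List (Fin n)) → d ≤ length vs → ∃[ t ] t ∈ e d vs
    nonempty-e zero vs _ = _ , here refl
    nonempty-e (suc d) (v ∷ vs) (s≤s d≤m) with nonempty-var* v (e d vs) (nonempty-e d vs d≤m)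
    ... | t , t∈ = t , ∈-++⁺ˡ t∈

    nonempty-h : ∀ d (vs : List (Fin n)) → 0 < length vs → ∃[ t ] t ∈ h d vs
    nonempty-h zero vs _ = _ , here refl
    nonempty-h (suc d) (v ∷ vs) _ with nonempty-var* v (h d (v ∷ vs)) (nonempty-h d (v ∷ vs) (s≤s z≤n))
    ... | t , t∈ = t , ∈-++⁺ˡ t∈


-- Sequences of polynomials (f_d)_d mirroring the series operations, so that
-- [tᵈ] (series built from e or h) is realised by an explicit polynomial f_d with the
-- expected values and with top part e_d resp. h_d.
module PolynomialSeries where

  open PowerSeries
  open Evaluation
  open TopDegree
  open import Data.Nat as ℕ using (ℕ; zero; suc; _≤_; s≤s)
  import Data.Nat.Properties as ℕP
  open import Data.Fin using (Fin)
  open import Data.List as List using (List; []; _∷_; _++_; foldr)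
  import Data.List.Properties as LP
  import Data.List.Relation.Unary.All as All
  import Data.List.Relation.Unary.All.Properties as AllP
  open import Data.Rational as ℚ using (ℚ; _+_; _*_)
  open import Data.Product using (_×_; _,_; proj₁; proj₂)
  open import Function using (_∘_)
  open import Relation.Binary.PropositionalEquality

  module _ {n : ℕ} where

    PolySeq : Set
    PolySeq = ℕ → Poly n

    mulByP : ℚ → PolySeq → PolySeq
    mulByP c a zero = a zero
    mulByP c a (suc d) = scale c (a d) ++ a (suc d)

    divByP : ℚ → PolySeq → PolySeq
    divByP c a zero = a zero
    divByP c a (suc d) = scale c (divByP c a d) ++ a (suc d)

    mulAllP : List ℚ → PolySeq → PolySeq
    mulAllP S a = foldr mulByP a S

    divAllP : List ℚ → PolySeq → PolySeq
    divAllP S a = foldr divByP a S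

    Evaluates : (Fin n → ℚ) → PolySeq → Seq → Set
    Evaluates z a b = ∀ d → eval (a d) z ≡ b d

    eval-mulByP : ∀ c {z a b} → Evaluates z a b → Evaluates z (mulByP c a) (mulBy c b)
    eval-mulByP c {z} {a} ev zero = ev zero
    eval-mulByP c {z} {a} ev (suc d) =
      trans (eval-++ (scale c (a d)) (a (suc d)) z)
        (cong₂ _+_ (trans (eval-scale c (a d) z) (cong (c *_) (ev d))) (ev (suc d)))

    eval-divByP : ∀ c {z a b} → Evaluates z a b → Evaluates z (divByP c a) (divBy c b)
    eval-divByP c {z} {a} ev zero = ev zero
    eval-divByP c {z} {a} ev (suc d) =
      trans (eval-++ (scale c (divByP c a d)) (a (suc d)) z)
        (cong₂ _+_ (trans (eval-scale c (divByP c a d) z) (cong (c *_) (eval-divByP c ev d))) (ev (suc d)))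

    eval-mulAllP : ∀ S {z a b} → Evaluates z a b → Evaluates z (mulAllP S a) (mulAll S b)
    eval-mulAllP [] ev = ev
    eval-mulAllP (s ∷ S) ev = eval-mulByP s (eval-mulAllP S ev)

    eval-divAllP : ∀ S {z a b} → Evaluates z a b → Evaluates z (divAllP S a) (divAll S b)
    eval-divAllP [] ev = ev
    eval-divAllP (s ∷ S) ev = eval-divByP s (eval-divAllP S ev)

    HasTop : PolySeq → PolySeq → Set
    HasTop a g = ∀ d → TopPart d (a d) (g d)

    monic-hasTop : ∀ g → (∀ d → MonicOfDegree d (g d)) → HasTop g g
    monic-hasTop g monic d =
      All.map (ℕP.≤-reflexive ∘ proj₂) (monic d) , LP.filter-all (ofDegree? d) (All.map proj₂ (monic d))

    top-add-lower : ∀ c {d} {f f' g : Poly n} → DegreeAtMost d f → TopPart (suc d) f' g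
                  → TopPart (suc d) (scale c f ++ f') g
    top-add-lower c {d} {f} {f'} f≤d (f'≤d+1 , top≡g) =
      AllP.++⁺ (AllP.map⁺ (All.map ℕP.m≤n⇒m≤1+n f≤d)) f'≤d+1 ,
      trans (LP.filter-++ (ofDegree? (suc d)) (scale c f) f')
            (cong₂ _++_ (LP.filter-none (ofDegree? (suc d)) (AllP.map⁺ (All.map (λ {t} → too-low {t}) f≤d))) top≡g)
      where
      too-low : ∀ {t : ℚ × Mono n} → mdeg (proj₂ t) ≤ d → mdeg (proj₂ t) ≢ suc d
      too-low t≤d t≡d+1 = ℕP.<-irrefl t≡d+1 (s≤s t≤d)

    top-mulByP : ∀ c {a g} → HasTop a g → HasTop (mulByP c a) g
    top-mulByP c top zero = top zero
    top-mulByP c top (suc d) = top-add-lower c (proj₁ (top d)) (top (suc d))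

    top-divByP : ∀ c {a g} → HasTop a g → HasTop (divByP c a) g
    top-divByP c top zero = top zero
    top-divByP c top (suc d) = top-add-lower c (proj₁ (top-divByP c top d)) (top (suc d))

    top-mulAllP : ∀ S {a g} → HasTop a g → HasTop (mulAllP S a) g
    top-mulAllP [] top = top
    top-mulAllP (s ∷ S) top = top-mulByP s (top-mulAllP S top)

    top-divAllP : ∀ S {a g} → HasTop a g → HasTop (divAllP S a) g
    top-divAllP [] top = top
    top-divAllP (s ∷ S) top = top-divByP s (top-divAllP S top)


module Counting where

  open import Data.Nat as ℕ using (ℕ; zero; suc; _≤_; _<_; _+_; z≤n; s≤s)
  import Data.Nat.Properties as ℕP
  open import Data.Fin as Fin using (Fin; toℕ)
  open import Data.List as List using (List; []; _∷_; _++_; [_]; allFin; filter; length)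
  import Data.List.Properties as LP
  open import Data.List.Membership.Propositional using (_∈_)
  open import Data.List.Membership.Propositional.Properties using (∈-∃++; ∈-++⁻; ∈-++⁺ˡ; ∈-++⁺ʳ; ∈-allFin)
  open import Data.List.Relation.Unary.All as All using (All; []; _∷_)
  import Data.List.Relation.Unary.All.Properties as AllP
  open import Data.List.Relation.Unary.Any using (here; there)
  open import Data.List.Relation.Unary.Unique.Propositional using (Unique)
  open import Data.List.Relation.Unary.AllPairs using ([]; _∷_)
  open import Data.List.Relation.Binary.Permutation.Propositional using (_↭_; prep) renaming (refl to ↭-refl; trans to ↭-trans)
  open import Data.List.Relation.Binary.Permutation.Propositional.Properties using (shift)
  open import Data.Nat.ListAction using (sum)
  open import Data.Product using (_×_; _,_; ∃-syntax)
  open import Data.Sum using (inj₁; inj₂)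
  open import Data.Empty using (⊥-elim)
  open import Data.Bool using (true; false)
  open import Function using (_∘_)
  open import Relation.Nullary using (¬_; does; yes; no)
  open import Relation.Nullary.Decidable using (_×-dec_)
  open import Relation.Unary using (Decidable; _≐_)
  open import Relation.Binary.PropositionalEquality hiding ([_])

  sub-multiset : {A : Set} (ys xs : List A) → Unique ys → All (_∈ xs) ys → ∃[ C ] (xs ↭ ys ++ C)
  sub-multiset [] xs _ _ = xs , ↭-refl
  sub-multiset (y ∷ ys) xs (y∉ys ∷ uniq) (y∈xs ∷ ys⊆xs) with ∈-∃++ y∈xs
  ... | pre , post , refl =
    let C , rest↭ys++C = sub-multiset ys (pre ++ post) uniq (All.zipWith still-in (ys⊆xs , y∉ys))
    in  C , ↭-trans (shift y pre post) (prep y rest↭ys++C)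
    where
    -- removing the occurrence of y from xs keeps every element of ys, since y ∉ ys
    still-in : ∀ {w} → w ∈ pre ++ [ y ] ++ post × y ≢ w → w ∈ pre ++ post
    still-in (w∈ , y≢w) with ∈-++⁻ pre w∈
    ... | inj₁ w∈pre = ∈-++⁺ˡ w∈pre
    ... | inj₂ (here refl) = ⊥-elim (y≢w refl)
    ... | inj₂ (there w∈post) = ∈-++⁺ʳ pre w∈post

  unique-map : ∀ {A B : Set} (f : A → B) (Q : A → Set) → (∀ x y → Q x → Q y → f x ≡ f y → x ≡ y)
             → ∀ xs → Unique xs → All Q xs → Unique (List.map f xs)
  unique-map f Q inj [] [] [] = []
  unique-map f Q inj (x ∷ xs) (x∉xs ∷ uniq) (qx ∷ qxs) =
    AllP.map⁺ (All.zipWith (λ { (x≢y , qy) fx≡fy → x≢y (inj _ _ qx qy fx≡fy) }) (x∉xs , qxs))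
    ∷ unique-map f Q inj xs uniq qxs

  length-filter-map : ∀ {A B : Set} {P : B → Set} (P? : Decidable P) (f : A → B) xs
                    → length (filter P? (List.map f xs)) ≡ length (filter (P? ∘ f) xs)
  length-filter-map P? f [] = refl
  length-filter-map P? f (x ∷ xs) with does (P? (f x))
  ... | true = cong suc (length-filter-map P? f xs)
  ... | false = length-filter-map P? f xs

  window? : (o a : ℕ) → Decidable (λ j → o ≤ j × j < o + a)
  window? o a j = (o ℕP.≤? j) ×-dec (j ℕP.<? o + a)

  count-shift : ∀ {W W' : ℕ → Set} (W? : Decidable W) (W'? : Decidable W') n → (W ∘ suc) ≐ W'
              → length (filter W? (List.tabulate {n = n} (suc ∘ toℕ))) ≡ length (filter W'? (List.tabulate {n = n} toℕ))
  count-shift W? W'? n W∘suc≐W' = begin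
    length (filter W? (List.tabulate {n = n} (suc ∘ toℕ))) ≡⟨ cong (length ∘ filter W?) (LP.map-tabulate {n = n} toℕ suc) ⟨
    length (filter W? (List.map suc indices))            ≡⟨ length-filter-map W? suc indices ⟩
    length (filter (W? ∘ suc) indices)                   ≡⟨ cong length (LP.filter-≐ (W? ∘ suc) W'? W∘suc≐W' indices) ⟩
    length (filter W'? indices)                          ∎
    where
    open ≡-Reasoning
    indices = List.tabulate {n = n} toℕ

  count-window : ∀ n o a → o + a ≤ n → length (filter (window? o a) (List.tabulate {n = n} toℕ)) ≡ a
  count-window zero zero zero _ = refl
  count-window (suc n) (suc o) a (s≤s o+a≤n) =
    trans (count-shift (window? (suc o) a) (window? o a) n
            ((λ { (s≤s o≤j , s≤s j<o+a) → o≤j , j<o+a }) , (λ { (o≤j , j<o+a) → s≤s o≤j , s≤s j<o+a })))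
          (count-window n o a o+a≤n)
  count-window (suc n) zero (suc a) (s≤s a≤n) =
    cong suc (trans (count-shift (window? 0 (suc a)) (window? 0 a) n
                      ((λ { (_ , s≤s j<a) → z≤n , j<a }) , (λ { (_ , j<a) → z≤n , s≤s j<a })))
                    (count-window n 0 a a≤n))
  count-window (suc n) zero zero _ =
    trans (count-shift (window? 0 0) (window? 0 0) n ((λ { (_ , ()) }) , (λ { (_ , ()) })))
          (count-window n 0 0 z≤n)

  module _ {A : Set} (w : A → ℕ) {P : A → Set} (P? : Decidable P) where

    sum-filter-≤ : ∀ xs → sum (List.map w (filter P? xs)) ≤ sum (List.map w xs)
    sum-filter-≤ [] = z≤n
    sum-filter-≤ (x ∷ xs) with does (P? x)
    ... | true = ℕP.+-monoʳ-≤ (w x) (sum-filter-≤ xs)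
    ... | false = ℕP.≤-trans (sum-filter-≤ xs) (ℕP.m≤n+m _ (w x))

    sum-filter-+-≤ : ∀ xs i → i ∈ xs → ¬ P i → sum (List.map w (filter P? xs)) + w i ≤ sum (List.map w xs)
    sum-filter-+-≤ (x ∷ xs) i i∈ ¬Pi with P? x
    sum-filter-+-≤ (x ∷ xs) i (here refl) ¬Pi | yes Px = ⊥-elim (¬Pi Px)
    sum-filter-+-≤ (x ∷ xs) i (there i∈) ¬Pi | yes _ =
      subst (_≤ w x + sum (List.map w xs)) (sym (ℕP.+-assoc (w x) _ (w i))) (ℕP.+-monoʳ-≤ (w x) (sum-filter-+-≤ xs i i∈ ¬Pi))
    sum-filter-+-≤ (x ∷ xs) i (here refl) ¬Pi | no _ =
      subst (_≤ w x + sum (List.map w xs)) (ℕP.+-comm (w x) _) (ℕP.+-monoʳ-≤ (w x) (sum-filter-≤ xs))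
    sum-filter-+-≤ (x ∷ xs) i (there i∈) ¬Pi | no _ = ℕP.≤-trans (sum-filter-+-≤ xs i i∈ ¬Pi) (ℕP.m≤n+m _ (w x))

  module _ {r : ℕ} (α : Fin r → ℕ) where

    block-end-≤ : ∀ i → offset α i + α i ≤ sum (List.map α (allFin r))
    block-end-≤ i = sum-filter-+-≤ α (λ l → toℕ l ℕP.<? toℕ i) (allFin r) i (∈-allFin i) (ℕP.<-irrefl refl)

    block-length : ∀ n i → offset α i + α i ≤ n → length (block α n i) ≡ α i
    block-length n i end≤n = begin
      length (block α n i)                                   ≡⟨ length-filter-map W? toℕ (allFin n) ⟨
      length (filter W? (List.map toℕ (allFin n)))           ≡⟨ cong (length ∘ filter W?) (LP.map-tabulate {n = n} (λ j → j) toℕ) ⟩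
      length (filter W? (List.tabulate {n = n} toℕ))         ≡⟨ count-window n (offset α i) (α i) end≤n ⟩
      α i                                                    ∎
      where
      open ≡-Reasoning
      W? = window? (offset α i) (α i)


module Generators where

  open PowerSeries
  open TopDegree
  open SymmetricPolynomials
  open PolynomialSeries
  open Counting
  open import Data.Nat as ℕ using (ℕ; _≤_; _<_; _+_)
  import Data.Nat.Properties as ℕP
  open import Data.Fin using (Fin)
  open import Data.List as List using (List; _++_; allFin; map; length)
  import Data.List.Properties as LP
  open import Data.List.Membership.Propositional using (_∈_)
  open import Data.List.Membership.Propositional.Properties using (∈-allFin; ∈-map⁺)
  open import Data.List.Relation.Unary.All as All using (All)
  import Data.List.Relation.Unary.All.Properties as AllP
  open import Data.List.Relation.Unary.Unique.Propositional using (Unique)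
  import Data.List.Relation.Unary.Unique.Propositional.Properties as UniqueP
  open import Data.List.Relation.Binary.Permutation.Propositional.Properties using (↭-length)
  open import Data.Rational using (ℚ; -_)
  open import Data.Product using (_,_; proj₁; proj₂; ∃-syntax)
  open import Function using (Injective)
  open import Relation.Binary.PropositionalEquality

  top-generator : ∀ {n} {Z : (Fin n → ℚ) → Set} {f g : Poly n} {d}
                → 𝐈 Z f → TopPart d f g → MonicOfDegree d g → ∃[ t ] t ∈ g → TGen Z g
  top-generator {f = f} vanishes top monic nonempty =
    f , vanishes , proj₂ (top-component top monic nonempty) , proj₁ (top-component top monic nonempty)

  complement-short : ∀ {n k c} d → n ≡ k + c → n < d + k → c < d
  complement-short {k = k} {c} d refl n<d+k = ℕP.+-cancelˡ-< k c d (subst (k + c <_) (ℕP.+-comm d k) n<d+k)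

  length-allFin : ∀ n → length (allFin n) ≡ n
  length-allFin n = LP.length-tabulate (λ j → j)

  module _ {r : ℕ} (α : Fin r → ℕ) (n k : ℕ) (η : Fin k → ℚ) (η-inj : Injective _≡_ _≡_ η) where

    values : List ℚ
    values = map η (allFin k)

    values-unique : Unique values
    values-unique = UniqueP.map⁺ η-inj (UniqueP.allFin⁺ k)

    length-values : length values ≡ k
    length-values = trans (LP.length-map η (allFin k)) (length-allFin k)

    -- For n - k < d ≤ n, e_d(x) is the top part of the coefficient of tᵈ in
    -- E(x, t) / ∏_l (1 + η_l t), which vanishes on Z_{α,k}.
    e-generator : ∀ d → n < d + k → d ≤ n → TGen (Zαk α n k η) (e d (allFin n))
    e-generator d n<d+k d≤n =
      top-generator vanishes (top-divAllP (map -_ values) (monic-hasTop _ (λ d → monic-e d (allFin n))) d)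
        (monic-e d (allFin n)) (nonempty-e d (allFin n) (subst (d ≤_) (sym (length-allFin n)) d≤n))
      where
      vanishes : 𝐈 (Zαk α n k η) (divAllP (map -_ values) (λ d → e d (allFin n)) d)
      vanishes z (_ , every-value-taken , _) = trans (eval-divAllP (map -_ values) (λ d → eval-e d (allFin n) z) d)
        (esym-quotient-vanishes values C X↭values++C d (complement-short d n-split n<d+k))
        where
        X = map z (allFin n)
        values⊆X : All (_∈ X) values
        values⊆X = AllP.map⁺ (All.tabulate (λ {l} _ →
                     subst (_∈ X) (proj₂ (every-value-taken l)) (∈-map⁺ z (∈-allFin (proj₁ (every-value-taken l))))))
        C = proj₁ (sub-multiset values X values-unique values⊆X)
        X↭values++C = proj₂ (sub-multiset values X values-unique values⊆X)
        n-split : n ≡ k + length C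
        n-split = begin
          n                         ≡⟨ trans (LP.length-map z (allFin n)) (length-allFin n) ⟨
          length X                  ≡⟨ ↭-length X↭values++C ⟩
          length (values ++ C)      ≡⟨ LP.length-++ values ⟩
          length values + length C  ≡⟨ cong (_+ length C) length-values ⟩
          k + length C              ∎
          where open ≡-Reasoning

    -- For k - α_i < d, h_d(x^{(i)}) is the top part of the coefficient of tᵈ in
    -- H(x^{(i)}, t) · ∏_l (1 - η_l t), which vanishes on Z_{α,k}.
    h-generator : ∀ i d → k < d + α i → 0 < α i → offset α i + α i ≤ n → TGen (Zαk α n k η) (h d (block α n i))
    h-generator i d k<d+αi αi>0 end≤n =
      top-generator vanishes (top-mulAllP (map -_ values) (monic-hasTop _ (λ d → monic-h d B)) d)
        (monic-h d B) (nonempty-h d B (subst (0 <_) (sym length-B) αi>0))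
      where
      B = block α n i
      length-B : length B ≡ α i
      length-B = block-length α n i end≤n
      vanishes : 𝐈 (Zαk α n k η) (mulAllP (map -_ values) (λ d → h d B) d)
      vanishes z (every-coordinate-a-value , _ , distinct-in-block) =
        trans (eval-mulAllP (map -_ values) (λ d → eval-h d B z) d)
          (hsym-product-vanishes A C values↭A++C d (complement-short d k-split k<d+αi))
        where
        A = map z B
        A-unique : Unique A
        A-unique = unique-map z (InBlock α i) (distinct-in-block i) B
                     (UniqueP.filter⁺ _ (UniqueP.allFin⁺ n)) (AllP.all-filter _ (allFin n))
        A⊆values : All (_∈ values) A
        A⊆values = AllP.map⁺ (All.tabulate (λ {j} _ →
                     subst (_∈ values) (sym (proj₂ (every-coordinate-a-value j)))
                       (∈-map⁺ η (∈-allFin (proj₁ (every-coordinate-a-value j))))))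
        C = proj₁ (sub-multiset A values A-unique A⊆values)
        values↭A++C = proj₂ (sub-multiset A values A-unique A⊆values)
        k-split : k ≡ α i + length C
        k-split = begin
          k                         ≡⟨ length-values ⟨
          length values             ≡⟨ ↭-length values↭A++C ⟩
          length (A ++ C)           ≡⟨ LP.length-++ A ⟩
          length A + length C       ≡⟨ cong (_+ length C) (trans (LP.length-map z B) length-B) ⟩
          α i + length C            ∎
          where open ≡-Reasoning

import Data.Nat as ℕ
import Data.List.Relation.Unary.All as All
open import Data.Product using (_,_)
open import Data.Sum using (inj₁; inj₂)
open import Relation.Binary.PropositionalEquality using (refl; subst)
open Counting
open Generators

lemma3p4 : (n k r : ℕ) → 0 < k → (α : Fin r → ℕ)
           → (∀ i → 1 ≤ α i) → (∀ i → α i ≤ k)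
           → sum (map α (allFin r)) ≡ n
           → (η : Fin k → ℚ) → Injective _≡_ _≡_ η
           → (p : Poly n) → 𝐉 α n k p → 𝐓 (Zαk α n k η) p
lemma3p4 n k r _ α α≥1 _ Σα≡n η η-inj p (cs , all-generators , p≈) = cs , All.map generator-in-T all-generators , p≈
  where
  generator-in-T : ∀ {g} → JGen α n k g → TGen (Zαk α n k η) g
  generator-in-T (inj₁ (d , n<d+k , d≤n , refl)) = e-generator α n k η η-inj d n<d+k d≤n
  generator-in-T (inj₂ (i , d , k<d+αi , _ , refl)) =
    h-generator α n k η η-inj i d k<d+αi (α≥1 i) (subst (offset α i ℕ.+ α i ≤_) Σα≡n (block-end-≤ α i))
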